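{- Let $G=(V,E)$ be a finite simple graph with adjacency matrix $A_G$. If $A_G$ has a weighted asteroidal triple, then $G$ contains an induced cycle of length at least 4, or an induced claw $K_{1,3}$, or an asteroidal triple.
   Context: $A_G$ is the $V\times V$ symmetric $0/1$ matrix with $(A_G)_{uv}=1$ iff $\{u,v\}\in E$ for $u\ne v$. For a symmetric matrix $A$ indexed by $V$ and $z\in V$, a path avoiding $z$ in $A$ is a sequence $(v_0,\dots,v_m)$ ($m\ge0$) of distinct elements of $V\setminus\{z\}$ with $A_{v_{i-1}v_i}>\min\{A_{v_{i-1}z},A_{v_iz}\}$ for $1\le i\le m$; $x\overset{z}{\sim}y$ means such a path from $x$ to $y$ exists. A weighted asteroidal triple of $A$ is a set $\{x,y,z\}$ of three distinct elements with $x\overset{z}{\sim}y$, $y\overset{x}{\sim}z$, $z\overset{y}{\sim}x$. An asteroidal triple of $G$ is an independent set $\{x,y,z\}$ of three vertices such that between any two of them there is a path in $G$ none of whose vertices is adjacent to the third. -}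

module Defs where

open import Data.Nat using (ℕ; zero; suc; _<_; _≤_; _⊓_)
open import Data.Fin using (Fin; toℕ)
open import Data.Bool using (Bool; true; false; if_then_else_)
open import Data.List using (List; head; last)
open import Data.Maybe using (just)
open import Data.List.Relation.Unary.All using (All)
open import Data.List.Relation.Unary.Linked using (Linked)
open import Data.List.Relation.Unary.Unique.Propositional using (Unique)
open import Data.Product using (Σ; _×_; ∃-syntax)
open import Data.Sum using (_⊎_)
open import Relation.Binary.PropositionalEquality using (_≡_; _≢_)
open import Function.Bundles using (_⇔_)

record Graph (n : ℕ) : Set where
  field
    adj     : Fin n → Fin n → Bool
    adj-sym : ∀ u v → adj u v ≡ adj v u
    adj-irr : ∀ v → adj v v ≡ false
open Graph public

Adj : ∀ {n} → Graph n → Fin n → Fin n → Set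
Adj G u v = adj G u v ≡ true

adjMatrix : ∀ {n} → Graph n → Fin n → Fin n → ℕ
adjMatrix G u v = if adj G u v then 1 else 0

-- Symmetric matrices indexed by Fin n (entries in ℕ suffice for A_G).
Symmetric : ∀ {n} → (Fin n → Fin n → ℕ) → Set
Symmetric A = ∀ u v → A u v ≡ A v u

record PathWith {n : ℕ} (P : Fin n → Set) (R : Fin n → Fin n → Set)
                (x y : Fin n) : Set where
  field
    verts    : List (Fin n)
    starts   : head verts ≡ just x
    ends     : last verts ≡ just y
    distinct : Unique verts
    allowed  : All P verts
    steps    : Linked R verts

_∼[_∖_]_ : ∀ {n} → Fin n → (Fin n → Fin n → ℕ) → Fin n → Fin n → Set
x ∼[ A ∖ z ] y = PathWith (λ v → v ≢ z) (λ u v → (A u z ⊓ A v z) < A u v) x y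

WeightedAT : ∀ {n} → (Fin n → Fin n → ℕ) → Fin n → Fin n → Fin n → Set
WeightedAT A x y z =
  x ≢ y × y ≢ z × x ≢ z ×
  x ∼[ A ∖ z ] y × y ∼[ A ∖ x ] z × z ∼[ A ∖ y ] x

HasWeightedAT : ∀ {n} → (Fin n → Fin n → ℕ) → Set
HasWeightedAT {n} A = ∃[ x ] ∃[ y ] ∃[ z ] WeightedAT {n} A x y z

AvoidPath : ∀ {n} → Graph n → Fin n → Fin n → Fin n → Set
AvoidPath G a b c = PathWith (λ v → adj G v c ≡ false) (Adj G) a b

AsteroidalTriple : ∀ {n} → Graph n → Fin n → Fin n → Fin n → Set
AsteroidalTriple G x y z =
  x ≢ y × y ≢ z × x ≢ z ×
  adj G x y ≡ false × adj G y z ≡ false × adj G x z ≡ false ×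
  AvoidPath G x y z × AvoidPath G y z x × AvoidPath G z x y

HasAT : ∀ {n} → Graph n → Set
HasAT {n} G = ∃[ x ] ∃[ y ] ∃[ z ] AsteroidalTriple {n} G x y z

CycAdj : (k : ℕ) → Fin k → Fin k → Set
CycAdj k i j =
  suc (toℕ i) ≡ toℕ j ⊎ suc (toℕ j) ≡ toℕ i ⊎
  (toℕ i ≡ 0 × suc (toℕ j) ≡ k) ⊎ (toℕ j ≡ 0 × suc (toℕ i) ≡ k)

HasInducedLongCycle : ∀ {n} → Graph n → Set
HasInducedLongCycle {n} G =
  Σ ℕ λ k → 4 ≤ k × Σ (Fin k → Fin n) λ c →
    (∀ i j → c i ≡ c j → i ≡ j) ×
    (∀ i j → Adj G (c i) (c j) ⇔ CycAdj k i j)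

HasInducedClaw : ∀ {n} → Graph n → Set
HasInducedClaw {n} G =
  Σ (Fin n) λ c → Σ (Fin n) λ a₁ → Σ (Fin n) λ a₂ → Σ (Fin n) λ a₃ →
    a₁ ≢ a₂ × a₂ ≢ a₃ × a₁ ≢ a₃ ×
    Adj G c a₁ × Adj G c a₂ × Adj G c a₃ ×
    adj G a₁ a₂ ≡ false × adj G a₂ a₃ ≡ false × adj G a₁ a₃ ≡ false

module Submission where

-- In A_G, a step u v of a path avoiding z means: u ~ v, and u, v are not both
-- adjacent to z.  Shortcut such a path to a chordless one; an interior vertex
-- adjacent to z is then the centre of a claw.  So, barring claws, each of the
-- three weighted paths gives a clear walk: a chordless path whose interior has
-- no neighbour of the avoided vertex.  Now split on the edges among x, y, z.
-- With none, {x, y, z} is an asteroidal triple.  With one or two, the clear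
-- walks close up with these edges into an induced cycle.  With a triangle,
-- each side has a common neighbour not adjacent to the third vertex, and
-- these three vertices give an induced 4-cycle or an asteroidal triple.  All
-- cycles come from one key lemma (commonNeighbourOrCycle): a walk between
-- neighbours of the two ends of an edge p q yields an induced cycle or a
-- common neighbour of p and q on the walk.

open import Defs
open import Data.Nat using (ℕ; zero; suc; _<_; _≤_; _⊓_; z≤n; s≤s; _+_)
open import Data.Nat.Properties using (≤-reflexive; ≤-pred; ≤-trans; n≤1+n; ≤∧≢⇒<; <-cmp; n≮0; n≮n)
  renaming (_≟_ to _≟ℕ_)
open import Data.Fin using (Fin; toℕ)
open import Data.Fin.Properties using (_≟_; toℕ-injective; toℕ<n)
open import Data.Bool using (Bool; true; false; _∧_; not)
open import Data.List using (List; []; _∷_; _++_; head; last)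
open import Data.Maybe using (just)
open import Data.List.Relation.Unary.All as All using (All; []; _∷_)
open import Data.List.Relation.Unary.All.Properties using (++⁺)
open import Data.List.Relation.Unary.Linked as Linked using (Linked; []; [-]; _∷_)
open import Data.List.Relation.Unary.AllPairs using ([]; _∷_)
open import Data.List.Relation.Unary.Unique.Propositional using (Unique)
open import Data.Product using (Σ; _×_; _,_; proj₁; proj₂)
open import Data.Sum using (_⊎_; inj₁; inj₂; map₂)
open import Data.Empty using (⊥; ⊥-elim)
open import Data.Unit using (⊤; tt)
open import Function.Bundles using (mk⇔)
open import Relation.Nullary using (¬_; yes; no)
open import Relation.Binary.Definitions using (DecidableEquality; tri<; tri≈; tri>)
open import Relation.Binary.PropositionalEquality using (_≡_; _≢_; refl; sym; trans; cong; subst; ≢-sym)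

-- Vertices may repeat; shortcutting
-- (below) turns a walk into a chordless one on a subset of its vertices.
data Walk {V : Set} (r : V → V → Bool) : V → V → Set where
  [_]  : (v : V) → Walk r v v
  cons : ∀ {v w} (u : V) → r u v ≡ true → Walk r v w → Walk r u w

true≢false : ∀ {b} → b ≡ true → b ≡ false → ⊥
true≢false refl ()

module _ {V : Set} {r : V → V → Bool} where

  verts rest front interior : ∀ {a b} → Walk r a b → List V
  verts [ v ]        = v ∷ []
  verts (cons u _ w) = u ∷ verts w

  rest [ v ]        = []
  rest (cons u _ w) = verts w

  front [ v ]        = []
  front (cons u _ w) = u ∷ front w

  interior [ v ]        = []
  interior (cons u _ w) = front w

  -- Number of vertices, and the i-th vertex (the last one for i too large).
  len : ∀ {a b} → Walk r a b → ℕ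
  len [ v ]        = 1
  len (cons u _ w) = suc (len w)

  at : ∀ {a b} → Walk r a b → ℕ → V
  at [ v ] _              = v
  at (cons u _ w) zero    = u
  at (cons u _ w) (suc i) = at w i

  Unrelated : V → V → Set
  Unrelated u v = r u v ≡ false × u ≢ v

  Chordless : ∀ {a b} → Walk r a b → Set
  Chordless [ v ]        = ⊤
  Chordless (cons u _ w) = All (Unrelated u) (rest w) × Chordless w

  data Suffix {c b : V} (s : Walk r c b) : ∀ {a} → Walk r a b → Set where
    here  : Suffix s s
    there : ∀ {u v} {e : r u v ≡ true} {w : Walk r v b} →
            Suffix s w → Suffix s (cons u e w)

  suffix-All : ∀ {a b c} {s : Walk r c b} {w : Walk r a b} → Suffix s w →
    ∀ {P : V → Set} → All P (verts w) → All P (verts s)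
  suffix-All here         ps       = ps
  suffix-All (there sf) (_ ∷ ps) = suffix-All sf ps

  suffix-Chordless : ∀ {a b c} {s : Walk r c b} {w : Walk r a b} → Suffix s w →
    Chordless w → Chordless s
  suffix-Chordless here       ch       = ch
  suffix-Chordless (there sf) (_ , ch) = suffix-Chordless sf ch

  All-first : ∀ {a b} (w : Walk r a b) {P : V → Set} → All P (verts w) → P a
  All-first [ v ]        (p ∷ _) = p
  All-first (cons u _ w) (p ∷ _) = p

  All-last : ∀ {a b} (w : Walk r a b) {P : V → Set} → All P (verts w) → P b
  All-last [ v ]        (p ∷ _)  = p
  All-last (cons u _ w) (_ ∷ ps) = All-last w ps

  All-rest : ∀ {a b} (w : Walk r a b) {P : V → Set} → All P (verts w) → All P (rest w)
  All-rest [ v ]        _        = []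
  All-rest (cons u _ w) (_ ∷ ps) = ps

  All-front : ∀ {a b} (w : Walk r a b) {P : V → Set} → All P (verts w) → All P (front w)
  All-front [ v ]        _        = []
  All-front (cons u _ w) (p ∷ ps) = p ∷ All-front w ps

  All-front-last : ∀ {a b} (w : Walk r a b) {P : V → Set} →
    All P (front w) → P b → All P (verts w)
  All-front-last [ v ]        _        pb = pb ∷ []
  All-front-last (cons u e w) (p ∷ ps) pb = p ∷ All-front-last w ps pb

  Within : ∀ {a b c d} → Walk r a b → Walk r c d → Set₁
  Within w' w = ∀ {P : V → Set} → All P (verts w) → All P (verts w')

  lastHit : (P : V → Bool) → ∀ {a b} (w : Walk r a b) →
    (Σ V λ c → Σ (Walk r c b) λ s →
       P c ≡ true × All (λ v → P v ≡ false) (rest s) × Suffix s w)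
    ⊎ All (λ v → P v ≡ false) (verts w)
  lastHit P [ v ] with P v in eq
  ... | true  = inj₁ (v , [ v ] , eq , [] , here)
  ... | false = inj₂ (eq ∷ [])
  lastHit P (cons u e w) with lastHit P w
  ... | inj₁ (c , s , pc , later , sf) = inj₁ (c , s , pc , later , there sf)
  ... | inj₂ none with P u in eq
  ...   | true  = inj₁ (u , cons u e w , eq , none , here)
  ...   | false = inj₂ (eq ∷ none)

  firstHit : (P : V → Bool) → ∀ {a b} (w : Walk r a b) → P b ≡ true →
    Σ V λ d → Σ (Walk r a d) λ t → P d ≡ true × All (λ v → P v ≡ false) (front t)
      × (Chordless w → Chordless t) × Within t w
      × (∀ {Q : V → Set} → All Q (rest w) → All Q (rest t))
  firstHit P [ v ] pb = v , [ v ] , pb , [] , (λ ch → ch) , (λ ps → ps) , (λ qs → qs)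
  firstHit P (cons u e w) pb with P u in eq
  ... | true = u , [ u ] , eq , [] , (λ _ → tt) , (λ { (p ∷ _) → p ∷ [] }) , (λ _ → [])
  ... | false with firstHit P w pb
  ...   | (d , t , pd , before , chord , within , rests) =
          d , cons u e t , pd , eq ∷ before , (λ { (f , ch) → rests f , chord ch }) ,
          (λ { (p ∷ ps) → p ∷ within ps }) , within

  -- These feed the cycle construction, which
  -- must present a cycle as a function of position.
  All-at : ∀ {a b} (w : Walk r a b) {P : V → Set} → All P (verts w) →
    ∀ i → i < len w → P (at w i)
  All-at [ v ]        (p ∷ _)  i       _          = p
  All-at (cons u _ w) (p ∷ _)  zero    _          = p
  All-at (cons u _ w) (_ ∷ ps) (suc i) (s≤s i<n) = All-at w ps i i<n

  rest-at : ∀ {a b} (w : Walk r a b) {P : V → Set} → All P (rest w) →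
    ∀ i → suc i < len w → P (at w (suc i))
  rest-at [ v ]        _  i (s≤s ())
  rest-at (cons u _ w) ps i (s≤s i<n) = All-at w ps i i<n

  front-at : ∀ {a b} (w : Walk r a b) {P : V → Set} → All P (front w) →
    ∀ i → suc i < len w → P (at w i)
  front-at [ v ]        _        i       (s≤s ())
  front-at (cons u _ w) (p ∷ _)  zero    _          = p
  front-at (cons u _ w) (_ ∷ ps) (suc i) (s≤s i<n) = front-at w ps i i<n

  step-at : ∀ {a b} (w : Walk r a b) → ∀ i → suc i < len w → r (at w i) (at w (suc i)) ≡ true
  step-at [ v ]                      i       (s≤s ())
  step-at (cons u e [ v ])           zero    _          = e
  step-at (cons u e (cons v e' w))   zero    _          = e
  step-at (cons u e w)               (suc i) (s≤s i<n) = step-at w i i<n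

  chordless-at : ∀ {a b} (w : Walk r a b) → Chordless w →
    ∀ i j → 2 + i ≤ j → j < len w → Unrelated (at w i) (at w j)
  chordless-at [ v ] _ i zero    () _
  chordless-at [ v ] _ i (suc j) _  (s≤s ())
  chordless-at (cons u e w) _       zero (suc zero)    (s≤s ()) _
  chordless-at (cons u e w) (f , _) zero (suc (suc j)) _ (s≤s j<n) = rest-at w f j j<n
  chordless-at (cons u e w) (_ , ch) (suc i) (suc j) (s≤s i≤j) (s≤s j<n) =
    chordless-at w ch i j i≤j j<n

  at-end : ∀ {a b} (w : Walk r a b) → ∀ i → len w ≤ suc i → at w i ≡ b
  at-end [ v ]                    i       _         = refl
  at-end (cons u e [ v ])         zero    (s≤s ())
  at-end (cons u e (cons _ _ _))  zero    (s≤s ())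
  at-end (cons u e w)             (suc i) (s≤s n≤i) = at-end w i n≤i

  snoc : ∀ {a b c} → Walk r a b → r b c ≡ true → Walk r a c
  snoc [ v ]         e = cons v e [ _ ]
  snoc (cons u e' w) e = cons u e' (snoc w e)

  len-snoc : ∀ {a b c} (w : Walk r a b) (e : r b c ≡ true) → len (snoc w e) ≡ suc (len w)
  len-snoc [ v ]         e = refl
  len-snoc (cons u e' w) e = cong suc (len-snoc w e)

  at-snoc : ∀ {a b c} (w : Walk r a b) (e : r b c ≡ true) →
    ∀ i → i < len w → at (snoc w e) i ≡ at w i
  at-snoc [ v ]         e zero    _          = refl
  at-snoc [ v ]         e (suc i) (s≤s ())
  at-snoc (cons u e' w) e zero    _          = refl
  at-snoc (cons u e' w) e (suc i) (s≤s i<n) = at-snoc w e i i<n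

  at-snoc-end : ∀ {a b c} (w : Walk r a b) (e : r b c ≡ true) → at (snoc w e) (len w) ≡ c
  at-snoc-end w e = at-end (snoc w e) (len w) (≤-reflexive (len-snoc w e))

  _+++_ : ∀ {a b c} → Walk r a b → Walk r b c → Walk r a c
  [ v ]        +++ w₂ = w₂
  cons u e w₁ +++ w₂ = cons u e (w₁ +++ w₂)

  verts-+++ : ∀ {a b c} (w₁ : Walk r a b) (w₂ : Walk r b c) →
    verts (w₁ +++ w₂) ≡ front w₁ ++ verts w₂
  verts-+++ [ v ]        w₂ = refl
  verts-+++ (cons u e w) w₂ = cong (u ∷_) (verts-+++ w w₂)

  dropLast : ∀ {v b} (u : V) (e : r u v ≡ true) (w : Walk r v b) →
    Σ V λ c → Σ (Walk r u c) λ i → r c b ≡ true ×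
      (∀ {P : V → Set} → All P (front (cons u e w)) → All P (verts i))
  dropLast u e [ v ] = u , [ u ] , e , λ { (p ∷ _) → p ∷ [] }
  dropLast u e (cons v e' w) with dropLast v e' w
  ... | (c , i , ec , within) = c , cons u e i , ec , λ { (p ∷ ps) → p ∷ within ps }

  Irreflexive : Set
  Irreflexive = ∀ {u v} → r u v ≡ true → u ≢ v

  module _ (irr : Irreflexive) where

    head-fresh : ∀ {u v b} (e : r u v ≡ true) (w : Walk r v b) →
      All (Unrelated u) (rest w) → All (u ≢_) (verts w)
    head-fresh e [ v ]         _ = irr e ∷ []
    head-fresh e (cons v e' w) f = irr e ∷ All.map proj₂ f

    last-fresh : ∀ {a b} (w : Walk r a b) → Chordless w → All (_≢ b) (front w)
    last-fresh [ v ]        _        = []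
    last-fresh (cons u e w) (f , ch) = All-last w (head-fresh e w f) ∷ last-fresh w ch

    chordless-unique : ∀ {a b} (w : Walk r a b) → Chordless w → Unique (verts w)
    chordless-unique [ v ]        _        = [] ∷ []
    chordless-unique (cons u e w) (f , ch) = head-fresh e w f ∷ chordless-unique w ch

  verts-linked : ∀ {a b} (w : Walk r a b) → Linked (λ u v → r u v ≡ true) (verts w)
  verts-linked [ v ]                    = [-]
  verts-linked (cons u e [ v ])         = e ∷ [-]
  verts-linked (cons u e (cons v e' w)) = e ∷ verts-linked (cons v e' w)

  verts-head : ∀ {a b} (w : Walk r a b) → head (verts w) ≡ just a
  verts-head [ v ]        = refl
  verts-head (cons u e w) = refl

  verts-last : ∀ {a b} (w : Walk r a b) → last (verts w) ≡ just b
  verts-last [ v ]                    = refl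
  verts-last (cons u e [ v ])         = refl
  verts-last (cons u e (cons v e' w)) = verts-last (cons v e' w)

module _ {V : Set} {r r' : V → V → Bool} (sub : ∀ {u v} → r u v ≡ true → r' u v ≡ true) where

  weaken : ∀ {a b} → Walk r a b → Walk r' a b
  weaken [ v ]        = [ v ]
  weaken (cons u e w) = cons u (sub e) (weaken w)

  verts-weaken : ∀ {a b} (w : Walk r a b) → verts (weaken w) ≡ verts w
  verts-weaken [ v ]        = refl
  verts-weaken (cons u e w) = cong (u ∷_) (verts-weaken w)

  front-weaken : ∀ {a b} (w : Walk r a b) → front (weaken w) ≡ front w
  front-weaken [ v ]        = refl
  front-weaken (cons u e w) = cong (u ∷_) (front-weaken w)

module Shortcut {V : Set} (_≟_ : DecidableEquality V) {r : V → V → Bool} where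

  reaches : V → V → Bool
  reaches h v with h ≟ v
  ... | yes _ = true
  ... | no  _ = r h v

  reaches-false : ∀ h v → reaches h v ≡ false → Unrelated {r = r} h v
  reaches-false h v eq with h ≟ v
  reaches-false h v () | yes _
  reaches-false h v eq | no h≢v = eq , h≢v

  reaches-true : ∀ h v → reaches h v ≡ true → h ≡ v ⊎ r h v ≡ true
  reaches-true h v eq with h ≟ v
  ... | yes h≡v = inj₁ h≡v
  ... | no  _   = inj₂ eq

  -- Shortcut the tail recursively, then jump from the head h directly to
  -- the last vertex of the shortened tail that is h or related to h.
  shortcut : ∀ {a b} (w : Walk r a b) → Σ (Walk r a b) λ w' → Chordless w' × Within w' w
  shortcut [ v ] = [ v ] , tt , λ ps → ps
  shortcut (cons h e w) with shortcut w
  ... | (w' , ch , within) with lastHit (reaches h) w'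
  ...   | inj₂ none = ⊥-elim (true≢false e (proj₁ (reaches-false h _ (All-first w' none))))
  ...   | inj₁ (c , s , hc , later , sf) with reaches-true h c hc
  ...     | inj₁ refl = s , suffix-Chordless sf ch , λ { (_ ∷ ps) → suffix-All sf (within ps) }
  ...     | inj₂ hrc  = cons h hrc s ,
                        (All.map (reaches-false h _) later , suffix-Chordless sf ch) ,
                        λ { (p ∷ ps) → p ∷ suffix-All sf (within ps) }

module InGraph {n : ℕ} (G : Graph n) where

  V : Set
  V = Fin n

  Adj-sym : ∀ {u v} → Adj G u v → Adj G v u
  Adj-sym {u} {v} uv = trans (adj-sym G v u) uv

  nonAdj-sym : ∀ {u v} → adj G u v ≡ false → adj G v u ≡ false
  nonAdj-sym {u} {v} uv = trans (adj-sym G v u) uv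

  Adj⇒≢ : ∀ {u v} → Adj G u v → u ≢ v
  Adj⇒≢ {u} uv refl = true≢false uv (adj-irr G u)

  edge? : ∀ u v → Adj G u v ⊎ adj G u v ≡ false
  edge? u v with adj G u v
  ... | true  = inj₁ refl
  ... | false = inj₂ refl

  module InducedCycle (K : ℕ) (3≤K : 3 ≤ K) (f : ℕ → V)
    (consecutive : ∀ i → i < K → Adj G (f i) (f (suc i)))
    (closing : Adj G (f 0) (f K)) (closing≢ : f 0 ≢ f K)
    (nonConsecutive : ∀ i j → 2 + i ≤ j → j ≤ K → (i ≡ 0 → j < K) →
                      adj G (f i) (f j) ≡ false × f i ≢ f j) where

    classify : ∀ i j → i < j → j ≤ K →
      suc i ≡ j ⊎ (i ≡ 0 × j ≡ K) ⊎ (adj G (f i) (f j) ≡ false × f i ≢ f j)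
    classify i j i<j j≤K with suc i ≟ℕ j
    ... | yes i+1≡j = inj₁ i+1≡j
    ... | no  i+1≢j with i ≟ℕ 0 | j ≟ℕ K
    ...   | yes i≡0 | yes j≡K = inj₂ (inj₁ (i≡0 , j≡K))
    ...   | yes i≡0 | no  j≢K =
            inj₂ (inj₂ (nonConsecutive i j (≤∧≢⇒< i<j i+1≢j) j≤K (λ _ → ≤∧≢⇒< j≤K j≢K)))
    ...   | no  i≢0 | _ =
            inj₂ (inj₂ (nonConsecutive i j (≤∧≢⇒< i<j i+1≢j) j≤K (λ i≡0 → ⊥-elim (i≢0 i≡0))))

    Cyclic : ℕ → ℕ → Set
    Cyclic i j = suc i ≡ j ⊎ suc j ≡ i ⊎ (i ≡ 0 × suc j ≡ suc K) ⊎ (j ≡ 0 × suc i ≡ suc K)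

    adj⇒cyclic : ∀ i j → i ≤ K → j ≤ K → Adj G (f i) (f j) → Cyclic i j
    adj⇒cyclic i j i≤K j≤K ij with <-cmp i j
    ... | tri≈ _ refl _ = ⊥-elim (true≢false ij (adj-irr G (f i)))
    ... | tri< i<j _ _ with classify i j i<j j≤K
    ...   | inj₁ i+1≡j                 = inj₁ i+1≡j
    ...   | inj₂ (inj₁ (i≡0 , j≡K))    = inj₂ (inj₂ (inj₁ (i≡0 , cong suc j≡K)))
    ...   | inj₂ (inj₂ (nonadj , _))   = ⊥-elim (true≢false ij nonadj)
    adj⇒cyclic i j i≤K j≤K ij | tri> _ _ j<i with classify j i j<i i≤K
    ...   | inj₁ j+1≡i                 = inj₂ (inj₁ j+1≡i)
    ...   | inj₂ (inj₁ (j≡0 , i≡K))    = inj₂ (inj₂ (inj₂ (j≡0 , cong suc i≡K)))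
    ...   | inj₂ (inj₂ (nonadj , _))   = ⊥-elim (true≢false (Adj-sym ij) nonadj)

    cyclic⇒adj : ∀ i j → i ≤ K → j ≤ K → Cyclic i j → Adj G (f i) (f j)
    cyclic⇒adj i j i≤K j≤K (inj₁ refl)                        = consecutive i j≤K
    cyclic⇒adj i j i≤K j≤K (inj₂ (inj₁ refl))                 = Adj-sym (consecutive j i≤K)
    cyclic⇒adj i j i≤K j≤K (inj₂ (inj₂ (inj₁ (refl , refl)))) = closing
    cyclic⇒adj i j i≤K j≤K (inj₂ (inj₂ (inj₂ (refl , refl)))) = Adj-sym closing

    distinct : ∀ i j → i < j → j ≤ K → f i ≢ f j
    distinct i j i<j j≤K fi≡fj with classify i j i<j j≤K
    ... | inj₁ refl = Adj⇒≢ (consecutive i j≤K) fi≡fj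
    ... | inj₂ (inj₁ (refl , refl)) = closing≢ fi≡fj
    ... | inj₂ (inj₂ (_ , fi≢fj))  = fi≢fj fi≡fj

    injective : ∀ i j → i ≤ K → j ≤ K → f i ≡ f j → i ≡ j
    injective i j i≤K j≤K fi≡fj with <-cmp i j
    ... | tri≈ _ i≡j _ = i≡j
    ... | tri< i<j _ _ = ⊥-elim (distinct i j i<j j≤K fi≡fj)
    ... | tri> _ _ j<i = ⊥-elim (distinct j i j<i i≤K (sym fi≡fj))

    inducedCycle : HasInducedLongCycle G
    inducedCycle = suc K , s≤s 3≤K , (λ i → f (toℕ i)) ,
      (λ i j eq → toℕ-injective (injective (toℕ i) (toℕ j) (bound i) (bound j) eq)) ,
      (λ i j → mk⇔ (adj⇒cyclic (toℕ i) (toℕ j) (bound i) (bound j))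
                   (cyclic⇒adj (toℕ i) (toℕ j) (bound i) (bound j)))
      where
        bound : (i : Fin (suc K)) → toℕ i ≤ K
        bound i = ≤-pred (toℕ<n i)

  closeCycle : ∀ {p q c d} (t : Walk (adj G) c d) → 2 ≤ len t →
    Adj G p q → p ≢ q → Adj G p c → Adj G q d → Chordless t →
    All (λ v → v ≢ p × v ≢ q) (verts t) →
    All (λ v → adj G p v ≡ false) (rest t) →
    All (λ v → adj G q v ≡ false) (front t) →
    HasInducedLongCycle G
  closeCycle {p} {q} {c} {d} t 2≤len pq p≢q pc qd chordless avoid pFar qFar =
      InducedCycle.inducedCycle K (s≤s 2≤len) f consecutive closing closing≢ nonConsecutive
    where
      dq : adj G d q ≡ true
      dq = Adj-sym qd

      f : ℕ → V
      f = at (cons p pc (snoc t dq))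

      K : ℕ
      K = suc (len t)

      fK : f K ≡ q
      fK = at-snoc-end t dq

      consecutive : ∀ i → i < K → Adj G (f i) (f (suc i))
      consecutive i i<K =
        step-at (cons p pc (snoc t dq)) i (subst (suc i <_) (sym (cong suc (len-snoc t dq))) (s≤s i<K))

      closing : Adj G (f 0) (f K)
      closing = subst (λ v → adj G p v ≡ true) (sym fK) pq

      closing≢ : f 0 ≢ f K
      closing≢ eq = p≢q (trans eq fK)

      -- Non-consecutive pairs: p against a later vertex of t, a vertex of t
      -- against q, or a chord-free pair inside t.
      nonConsecutive : ∀ i j → 2 + i ≤ j → j ≤ K → (i ≡ 0 → j < K) →
                       adj G (f i) (f j) ≡ false × f i ≢ f j
      nonConsecutive zero (suc zero) (s≤s ()) _ _
      nonConsecutive zero (suc (suc j)) _ _ j<K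
        rewrite at-snoc t dq (suc j) (≤-pred (j<K refl)) =
          rest-at t pFar j (≤-pred (j<K refl)) ,
          (λ eq → proj₁ (rest-at t (All-rest t avoid) j (≤-pred (j<K refl))) (sym eq))
      nonConsecutive (suc i) (suc j) (s≤s i+2≤j) (s≤s j≤len) _ with j ≟ℕ len t
      ... | yes refl rewrite at-snoc-end t dq | at-snoc t dq i (≤-trans (n≤1+n (suc i)) i+2≤j) =
            nonAdj-sym (front-at t qFar i i+2≤j) ,
            proj₂ (All-at t avoid i (≤-trans (n≤1+n (suc i)) i+2≤j))
      ... | no j≢len rewrite at-snoc t dq i (≤-trans (≤-trans (n≤1+n (suc i)) i+2≤j) j≤len)
                           | at-snoc t dq j (≤∧≢⇒< j≤len j≢len) =
            chordless-at t chordless i j i+2≤j (≤∧≢⇒< j≤len j≢len)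

  fourCycle : ∀ {a b c d} → Adj G a b → Adj G b c → Adj G c d → Adj G a d →
    adj G a c ≡ false → a ≢ c → adj G b d ≡ false → b ≢ d → a ≢ d → HasInducedLongCycle G
  fourCycle {a} {b} {c} {d} ab bc cd ad ac a≢c bd b≢d a≢d =
    closeCycle (cons b bc [ c ]) (s≤s (s≤s z≤n)) ad a≢d ab (Adj-sym cd) ([] , tt)
      ((≢-sym (Adj⇒≢ ab) , b≢d) ∷ (≢-sym a≢c , Adj⇒≢ cd) ∷ [])
      (ac ∷ []) (nonAdj-sym bd ∷ [])

  len-positive : ∀ {r : V → V → Bool} {a b} (w : Walk r a b) → 1 ≤ len w
  len-positive [ v ]        = s≤s z≤n
  len-positive (cons u e w) = s≤s z≤n

  open Shortcut (_≟_ {n})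

  -- Proof: shortcut L, keep the part after its last neighbour
  -- of p and up to the next neighbour of q; a single vertex is a common
  -- neighbour, a longer piece closes to an induced cycle.
  commonNeighbourOrCycle : ∀ {p q a b} (Q : V → Set) → Adj G p q → p ≢ q →
    (L : Walk (adj G) a b) → Adj G p a → Adj G q b →
    All (λ v → v ≢ p × v ≢ q × Q v) (verts L) →
    HasInducedLongCycle G ⊎ Σ V (λ v → Adj G p v × Adj G q v × Q v)
  commonNeighbourOrCycle {p} {q} Q pq p≢q L pa qb good with shortcut L
  ... | (L' , chordless , within) with lastHit (adj G p) L'
  ...   | inj₂ none = ⊥-elim (true≢false pa (All-first L' none))
  ...   | inj₁ (c , s , pc , pFar , sf) with firstHit (adj G q) s qb
  ...     | (d , t , qd , qFar , chord , within' , rests) =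
              finish t pc qd (chord (suffix-Chordless sf chordless))
                     (within' (suffix-All sf (within good))) (rests pFar) qFar
    where
      finish : ∀ {c d} (t : Walk (adj G) c d) → Adj G p c → Adj G q d → Chordless t →
        All (λ v → v ≢ p × v ≢ q × Q v) (verts t) →
        All (λ v → adj G p v ≡ false) (rest t) → All (λ v → adj G q v ≡ false) (front t) →
        HasInducedLongCycle G ⊎ Σ V (λ v → Adj G p v × Adj G q v × Q v)
      finish [ c ] pc qc _ ((_ , _ , Qc) ∷ []) _ _ = inj₂ (c , pc , qc , Qc)
      finish t@(cons _ _ t') pc qd chordless' good' pFar' qFar' =
        inj₁ (closeCycle t (s≤s (len-positive t')) pq p≢q pc qd chordless'
                (All.map (λ { (v≢p , v≢q , _) → v≢p , v≢q }) good') pFar' qFar')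

  -- In A_G, the step condition (A u c ⊓ A v c) < A u v of a path avoiding c
  -- says: u ~ v, and u, v are not both adjacent to c.
  avoidStep : V → V → V → Bool
  avoidStep c u v = adj G u v ∧ not (adj G u c ∧ adj G v c)

  module _ {c : V} where

    weighted⇒avoidStep : ∀ {u v} → (adjMatrix G u c ⊓ adjMatrix G v c) < adjMatrix G u v →
      avoidStep c u v ≡ true
    weighted⇒avoidStep {u} {v} lt with adj G u v | adj G u c | adj G v c
    ... | false | _     | _     = ⊥-elim (n≮0 lt)
    ... | true  | false | _     = refl
    ... | true  | true  | false = refl
    ... | true  | true  | true  = ⊥-elim (n≮n 1 lt)

    avoidStep⇒Adj : ∀ {u v} → avoidStep c u v ≡ true → Adj G u v
    avoidStep⇒Adj {u} {v} uv with adj G u v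
    ... | true  = refl
    ... | false = uv

    avoidStep-irreflexive : Irreflexive {r = avoidStep c}
    avoidStep-irreflexive uv = Adj⇒≢ (avoidStep⇒Adj uv)

    avoidStep-left : ∀ {u v} → avoidStep c u v ≡ true → Adj G v c → adj G u c ≡ false
    avoidStep-left {u} {v} uv vc with adj G u v | adj G u c | adj G v c
    ... | false | _     | _     = ⊥-elim (true≢false uv refl)
    ... | true  | false | _     = refl
    ... | true  | true  | true  = ⊥-elim (true≢false uv refl)
    ... | true  | true  | false = ⊥-elim (true≢false vc refl)

    avoidStep-right : ∀ {u v} → avoidStep c u v ≡ true → Adj G u c → adj G v c ≡ false
    avoidStep-right {u} {v} uv uc with adj G u v | adj G u c | adj G v c
    ... | false | _     | _     = ⊥-elim (true≢false uv refl)
    ... | true  | _     | false = refl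
    ... | true  | true  | true  = ⊥-elim (true≢false uv refl)
    ... | true  | false | true  = ⊥-elim (true≢false uc refl)

    avoidStep-false : ∀ {u v} → avoidStep c u v ≡ false → adj G u c ≡ false → adj G u v ≡ false
    avoidStep-false {u} {v} uv uc with adj G u v | adj G u c
    ... | false | _     = refl
    ... | true  | false = uv
    ... | true  | true  = ⊥-elim (true≢false refl uc)

    -- Three consecutive vertices u, v, d of a chordless avoiding walk with
    -- v ~ c: u, d are non-adjacent to c and to each other, so v is the centre
    -- of a claw with leaves u, d, c.
    clawAt : ∀ {u v d} → avoidStep c u v ≡ true → avoidStep c v d ≡ true →
      Unrelated {r = avoidStep c} u d → u ≢ c → d ≢ c → Adj G v c → HasInducedClaw G
    clawAt {u} {v} {d} uv vd (ud , u≢d) u≢c d≢c vc =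
      v , u , d , c , u≢d , d≢c , u≢c ,
      Adj-sym (avoidStep⇒Adj uv) , avoidStep⇒Adj vd , vc ,
      avoidStep-false ud (avoidStep-left uv vc) , avoidStep-right vd vc , avoidStep-left uv vc

    clawOrFarInterior : ∀ {a b} (w : Walk (avoidStep c) a b) → Chordless w → All (_≢ c) (verts w) →
      HasInducedClaw G ⊎ All (λ v → adj G v c ≡ false) (interior w)
    clawOrFarInterior [ v ]            _ _ = inj₂ []
    clawOrFarInterior (cons u e [ v ]) _ _ = inj₂ []
    clawOrFarInterior (cons u uv (cons v vd w)) (uFar , chordless) (u≢c ∷ v≢c ∷ rest≢c)
      with edge? v c | clawOrFarInterior (cons v vd w) chordless (v≢c ∷ rest≢c)
    ... | inj₁ vc | _         = inj₁ (clawAt uv vd (All-first w uFar) u≢c (All-first w rest≢c) vc)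
    ... | inj₂ _  | inj₁ claw = inj₁ claw
    ... | inj₂ vc | inj₂ far  = inj₂ (vc ∷ far)

  record ClearWalk (c a b : V) : Set where
    constructor clear
    field
      walk      : Walk (avoidStep c) a b
      chordless : Chordless walk
      missesC   : All (_≢ c) (verts walk)
      farInside : All (λ v → adj G v c ≡ false) (interior walk)

  pathToWalk : ∀ {z y} (v : V) (vs : List V) → last (v ∷ vs) ≡ just y →
    Linked (λ u w → (adjMatrix G u z ⊓ adjMatrix G w z) < adjMatrix G u w) (v ∷ vs) →
    Σ (Walk (avoidStep z) v y) λ w → verts w ≡ v ∷ vs
  pathToWalk v []       refl [-]            = [ v ] , refl
  pathToWalk v (u ∷ vs) end  (step ∷ steps) with pathToWalk u vs end steps
  ... | (w , eq) = cons v (weighted⇒avoidStep step) w , cong (v ∷_) eq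

  clearWalkOrClaw : ∀ {x y z} → x ∼[ adjMatrix G ∖ z ] y → HasInducedClaw G ⊎ ClearWalk z x y
  clearWalkOrClaw record { verts = [] ; starts = () }
  clearWalkOrClaw {x} {y} {z}
    record { verts = v ∷ vs ; starts = refl ; ends = end ; allowed = allowed ; steps = steps }
    with pathToWalk v vs end steps
  ... | (w , eq) with shortcut w
  ...   | (w' , chordless , within) =
          map₂ (clear w' chordless missesZ) (clawOrFarInterior w' chordless missesZ)
    where
      missesZ : All (_≢ z) (verts w')
      missesZ = within (subst (All (_≢ z)) (sym eq) allowed)

  clearWalk⇒AvoidPath : ∀ {a b c} → ClearWalk c a b → adj G a c ≡ false → adj G b c ≡ false →
    AvoidPath G a b c
  clearWalk⇒AvoidPath {a} {b} {c} (clear w chordless _ far) ac bc = record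
    { verts    = verts w
    ; starts   = verts-head w
    ; ends     = verts-last w
    ; distinct = chordless-unique avoidStep-irreflexive w chordless
    ; allowed  = allFar w ac far
    ; steps    = Linked.map avoidStep⇒Adj (verts-linked w) }
    where
      allFar : ∀ {a} (w : Walk (avoidStep c) a b) → adj G a c ≡ false →
        All (λ v → adj G v c ≡ false) (interior w) → All (λ v → adj G v c ≡ false) (verts w)
      allFar [ v ]        ac _   = ac ∷ []
      allFar (cons u e w) ac far = ac ∷ All-front-last w far bc

  twoStepAvoidPath : ∀ {u m w c} → Adj G u m → Adj G m w → u ≢ w →
    adj G u c ≡ false → adj G m c ≡ false → adj G w c ≡ false → AvoidPath G u w c
  twoStepAvoidPath um mw u≢w uc mc wc = record
    { verts    = _ ∷ _ ∷ _ ∷ []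
    ; starts   = refl
    ; ends     = refl
    ; distinct = (Adj⇒≢ um ∷ u≢w ∷ []) ∷ (Adj⇒≢ mw ∷ []) ∷ [] ∷ []
    ; allowed  = uc ∷ mc ∷ wc ∷ []
    ; steps    = um ∷ mw ∷ [-] }

  -- Endpoint facts of a clear walk: being chordless, it returns to neither
  -- of its endpoints.
  module _ {c a b : V} (W : ClearWalk c a b) where
    open ClearWalk W

    rest≢start : All (a ≢_) (rest walk)
    rest≢start with walk | chordless
    ... | [ _ ]        | _         = []
    ... | cons _ e w   | (f , _)   = head-fresh avoidStep-irreflexive e w f

    front≢end : All (_≢ b) (front walk)
    front≢end = last-fresh avoidStep-irreflexive walk chordless

  dropEnd : ∀ {c a b} (Q : V → Set) → ClearWalk c a b → a ≢ b → Q a →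
    (∀ {v} → adj G v c ≡ false → Q v) →
    Σ V λ d → Σ (Walk (adj G) a d) λ L → Adj G b d × All (λ v → v ≢ c × v ≢ b × Q v) (verts L)
  dropEnd Q (clear [ _ ] _ _ _) a≢b _ _ = ⊥-elim (a≢b refl)
  dropEnd {c} {a} {b} Q W@(clear (cons _ e w) _ missesC farInside) _ Qa farQ
    with dropLast a e w
  ... | (d , L , db , within) =
        d , weaken avoidStep⇒Adj L , Adj-sym (avoidStep⇒Adj db) ,
        subst (All _) (sym (verts-weaken avoidStep⇒Adj L))
          (within (All.zip (All-front (cons a e w) missesC ,
                   All.zip (front≢end W , Qa ∷ All.map farQ farInside))))

  triangleSide : ∀ {x y z} → ClearWalk z x y → Adj G x y → Adj G x z → Adj G y z → x ≢ y →
    HasInducedLongCycle G ⊎ Σ V (λ a → Adj G x a × Adj G y a × adj G a z ≡ false × a ≢ z)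
  triangleSide (clear [ _ ] _ _ _) _ _ _ x≢y = ⊥-elim (x≢y refl)
  triangleSide (clear (cons _ e [ _ ]) _ _ _) _ xz yz _ = ⊥-elim (true≢false xz (avoidStep-left e yz))
  triangleSide {x} {y} {z} W@(clear (cons _ e (cons v e' w)) _ missesC farInside) xy _ _ x≢y
    with dropLast v e' w
  ... | (d , L , dy , within) =
        commonNeighbourOrCycle (λ u → adj G u z ≡ false × u ≢ z) xy x≢y
          (weaken avoidStep⇒Adj L) (avoidStep⇒Adj e) (Adj-sym (avoidStep⇒Adj dy))
          (subst (All _) (sym (verts-weaken avoidStep⇒Adj L)) (within good))
    where
      tail = cons v e' w
      good : All (λ u → u ≢ x × u ≢ y × adj G u z ≡ false × u ≢ z) (front tail)
      good = All.zip (All-front tail (All.map ≢-sym (rest≢start W)) ,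
             All.zip (All.tail (front≢end W) ,
             All.zip (farInside , All-front tail (All.tail missesC))))

  cycleFromWalk : ∀ {p q a b} → Adj G p q → p ≢ q → (L : Walk (adj G) a b) → Adj G p a → Adj G q b →
    All (λ v → v ≢ p × v ≢ q × ¬ (Adj G p v × Adj G q v)) (verts L) → HasInducedLongCycle G
  cycleFromWalk pq p≢q L pa qb good with commonNeighbourOrCycle _ pq p≢q L pa qb good
  ... | inj₁ cycle                    = cycle
  ... | inj₂ (v , pv , qv , notCommon) = ⊥-elim (notCommon (pv , qv))

  -- The clear walk z → x around y, for x ≁ z, minus its end x: a walk from z
  -- to a neighbour of x that misses y, x and all common neighbours of x, y
  -- (inner vertices are not adjacent to y, and z is not adjacent to x).
  towardsX : ∀ {x y z} → x ≢ z → adj G x z ≡ false → ClearWalk y z x →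
    Σ V λ d → Σ (Walk (adj G) z d) λ L → Adj G x d ×
      All (λ v → v ≢ y × v ≢ x × ¬ (Adj G y v × Adj G x v)) (verts L)
  towardsX x≢z xz W = dropEnd _ W (≢-sym x≢z) (λ { (_ , xz') → true≢false xz' xz })
                                (λ vy → λ { (yv , _) → true≢false (Adj-sym yv) vy })

  -- Exactly one edge x y: the clear walk y → z around x followed by the walk
  -- towardsX runs from a neighbour of y to a neighbour of x.
  oneEdgeCase : ∀ {x y z} → x ≢ y → y ≢ z → x ≢ z → Adj G x y → adj G x z ≡ false →
    ClearWalk x y z → ClearWalk y z x → HasInducedLongCycle G
  oneEdgeCase _ y≢z _ _ _ (clear [ _ ] _ _ _) _ = ⊥-elim (y≢z refl)
  oneEdgeCase {x} {y} x≢y y≢z x≢z xy xz W₂@(clear (cons _ e w) _ missesX farInside) W₃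
    with towardsX x≢z xz W₃
  ... | (d , L₃ , xd , good₃) =
        cycleFromWalk (Adj-sym xy) (≢-sym x≢y) (weaken avoidStep⇒Adj w +++ L₃)
          (avoidStep⇒Adj e) xd
          (subst (All _) (sym (verts-+++ (weaken avoidStep⇒Adj w) L₃))
            (++⁺ (subst (All _) (sym (front-weaken avoidStep⇒Adj w)) good₂) good₃))
    where
      good₂ : All (λ v → v ≢ y × v ≢ x × ¬ (Adj G y v × Adj G x v)) (front w)
      good₂ = All.zip (All-front w (All.map ≢-sym (rest≢start W₂)) ,
              All.zip (All-front w (All.tail missesX) ,
                       All.map (λ vx → λ { (_ , xv) → true≢false (Adj-sym xv) vx }) farInside))

  -- Two edges x y, y z: the walk towardsX already starts at the neighbour z
  -- of y.
  twoEdgeCase : ∀ {x y z} → x ≢ y → x ≢ z → Adj G x y → Adj G y z → adj G x z ≡ false →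
    ClearWalk y z x → HasInducedLongCycle G
  twoEdgeCase x≢y x≢z xy yz xz W₃ with towardsX x≢z xz W₃
  ... | (d , L₃ , xd , good₃) = cycleFromWalk (Adj-sym xy) (≢-sym x≢y) L₃ yz xd good₃

  Outcome : Set
  Outcome = HasInducedLongCycle G ⊎ HasInducedClaw G ⊎ HasAT G

  -- Let a be a common neighbour of x, y but not of z (a ≠ z), and b, c
  -- likewise for y, z and z, x.  Two adjacent ones among a, b, c lie on an
  -- induced 4-cycle (e.g. a b z x); otherwise a, b, c form an asteroidal
  -- triple, a and b being joined through y, b and c through z, c and a
  -- through x.
  threeNeighbours : ∀ {x y z a b c} → Adj G x y → Adj G y z → Adj G z x →
    Adj G x a → Adj G y a → adj G a z ≡ false → a ≢ z →
    Adj G y b → Adj G z b → adj G b x ≡ false → b ≢ x →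
    Adj G z c → Adj G x c → adj G c y ≡ false → c ≢ y → Outcome
  threeNeighbours {x} {y} {z} {a} {b} {c} xy yz zx xa ya az a≢z yb zb bx b≢x zc xc cy c≢y
    with edge? a b | edge? b c | edge? c a
  ... | inj₁ ab | _ | _ =
        inj₁ (fourCycle ab (Adj-sym zb) zx (Adj-sym xa) az a≢z bx b≢x (≢-sym (Adj⇒≢ xa)))
  ... | inj₂ _ | inj₁ bc | _ =
        inj₁ (fourCycle bc (Adj-sym xc) xy (Adj-sym yb) bx b≢x cy c≢y (≢-sym (Adj⇒≢ yb)))
  ... | inj₂ _ | inj₂ _ | inj₁ ca =
        inj₁ (fourCycle ca (Adj-sym ya) yz (Adj-sym zc) cy c≢y az a≢z (≢-sym (Adj⇒≢ zc)))
  ... | inj₂ ab | inj₂ bc | inj₂ ca = inj₂ (inj₂ (a , b , c , a≢b , b≢c , a≢c , ab , bc , nonAdj-sym ca ,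
        twoStepAvoidPath (Adj-sym ya) yb a≢b (nonAdj-sym ca) (nonAdj-sym cy) bc ,
        twoStepAvoidPath (Adj-sym zb) zc b≢c (nonAdj-sym ab) (nonAdj-sym az) ca ,
        twoStepAvoidPath (Adj-sym xc) xa (≢-sym a≢c) (nonAdj-sym bc) (nonAdj-sym bx) ab))
    where
      a≢b : a ≢ b
      a≢b refl = true≢false (Adj-sym zb) az
      b≢c : b ≢ c
      b≢c refl = true≢false (Adj-sym xc) bx
      a≢c : a ≢ c
      a≢c refl = true≢false (Adj-sym ya) cy

  triangleCase : ∀ {x y z} → x ≢ y → y ≢ z → x ≢ z →
    ClearWalk z x y → ClearWalk x y z → ClearWalk y z x →
    Adj G x y → Adj G y z → Adj G z x → Outcome
  triangleCase x≢y y≢z x≢z W₁ W₂ W₃ xy yz zx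
    with triangleSide W₁ xy (Adj-sym zx) yz x≢y
       | triangleSide W₂ yz (Adj-sym xy) zx y≢z
       | triangleSide W₃ zx (Adj-sym yz) xy (≢-sym x≢z)
  ... | inj₁ cycle | _ | _ = inj₁ cycle
  ... | inj₂ _ | inj₁ cycle | _ = inj₁ cycle
  ... | inj₂ _ | inj₂ _ | inj₁ cycle = inj₁ cycle
  ... | inj₂ (a , xa , ya , az , a≢z) | inj₂ (b , yb , zb , bx , b≢x) | inj₂ (c , zc , xc , cy , c≢y) =
        threeNeighbours xy yz zx xa ya az a≢z yb zb bx b≢x zc xc cy c≢y

  byAdjacency : ∀ {x y z} → x ≢ y → y ≢ z → x ≢ z →
    ClearWalk z x y → ClearWalk x y z → ClearWalk y z x →
    Adj G x y ⊎ adj G x y ≡ false → Adj G y z ⊎ adj G y z ≡ false →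
    Adj G z x ⊎ adj G z x ≡ false → Outcome
  byAdjacency {x} {y} {z} x≢y y≢z x≢z W₁ W₂ W₃ (inj₂ xy) (inj₂ yz) (inj₂ zx) =
    inj₂ (inj₂ (x , y , z , x≢y , y≢z , x≢z , xy , yz , nonAdj-sym zx ,
      clearWalk⇒AvoidPath W₁ (nonAdj-sym zx) yz ,
      clearWalk⇒AvoidPath W₂ (nonAdj-sym xy) zx ,
      clearWalk⇒AvoidPath W₃ (nonAdj-sym yz) xy))
  byAdjacency x≢y y≢z x≢z W₁ W₂ W₃ (inj₁ xy) (inj₂ yz) (inj₂ zx) =
    inj₁ (oneEdgeCase x≢y y≢z x≢z xy (nonAdj-sym zx) W₂ W₃)
  byAdjacency x≢y y≢z x≢z W₁ W₂ W₃ (inj₂ xy) (inj₁ yz) (inj₂ zx) =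
    inj₁ (oneEdgeCase y≢z (≢-sym x≢z) (≢-sym x≢y) yz (nonAdj-sym xy) W₃ W₁)
  byAdjacency x≢y y≢z x≢z W₁ W₂ W₃ (inj₂ xy) (inj₂ yz) (inj₁ zx) =
    inj₁ (oneEdgeCase (≢-sym x≢z) x≢y (≢-sym y≢z) zx (nonAdj-sym yz) W₁ W₂)
  byAdjacency x≢y y≢z x≢z W₁ W₂ W₃ (inj₁ xy) (inj₁ yz) (inj₂ zx) =
    inj₁ (twoEdgeCase x≢y x≢z xy yz (nonAdj-sym zx) W₃)
  byAdjacency x≢y y≢z x≢z W₁ W₂ W₃ (inj₂ xy) (inj₁ yz) (inj₁ zx) =
    inj₁ (twoEdgeCase y≢z (≢-sym x≢y) yz zx (nonAdj-sym xy) W₁)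
  byAdjacency x≢y y≢z x≢z W₁ W₂ W₃ (inj₁ xy) (inj₂ yz) (inj₁ zx) =
    inj₁ (twoEdgeCase (≢-sym x≢z) (≢-sym y≢z) zx xy (nonAdj-sym yz) W₂)
  byAdjacency x≢y y≢z x≢z W₁ W₂ W₃ (inj₁ xy) (inj₁ yz) (inj₁ zx) =
    triangleCase x≢y y≢z x≢z W₁ W₂ W₃ xy yz zx

open InGraph using (clearWalkOrClaw; byAdjacency; edge?)

lemma4p4 : (n : ℕ) (G : Graph n) → HasWeightedAT (adjMatrix G) →
    HasInducedLongCycle G ⊎ HasInducedClaw G ⊎ HasAT G
lemma4p4 n G (x , y , z , x≢y , y≢z , x≢z , x∼y , y∼z , z∼x)
  with clearWalkOrClaw G x∼y | clearWalkOrClaw G y∼z | clearWalkOrClaw G z∼x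
... | inj₁ claw | _         | _         = inj₂ (inj₁ claw)
... | inj₂ _    | inj₁ claw | _         = inj₂ (inj₁ claw)
... | inj₂ _    | inj₂ _    | inj₁ claw = inj₂ (inj₁ claw)
... | inj₂ W₁   | inj₂ W₂   | inj₂ W₃   =
      byAdjacency G x≢y y≢z x≢z W₁ W₂ W₃ (edge? G x y) (edge? G y z) (edge? G z x)
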